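{- Let $(G,\le_G)$ be an ordered group and $A\in\mathrm{P}_{\mathrm{fe}}^*(G)$. The following are equivalent: (1) $A\vdash_{\rhd_{\mathrm s}}0$; (2) there is an integer $n\ge1$ such that $A^{(n)}\rhd_{\mathrm s}0$, i.e. there are $a_1,\dots,a_k\in A$ and integers $n_1,\dots,n_k\ge0$, not all zero, such that $n_1a_1+\dots+n_ka_k\le_G0$.
   Context: Groups are commutative; an ordered group has a partial order compatible with addition. $\mathrm{P}_{\mathrm{fe}}^*(G)$ is the set of nonempty finite subsets of $G$; $A^{(n)}=A+\dots+A$ ($n$ times), where $A+B=\{a+b\}$, and $A-B=\{a-b\}$. The relation $\rhd_{\mathrm s}$ between $\mathrm{P}_{\mathrm{fe}}^*(G)$ and $G$ is $A\rhd_{\mathrm s}b$ iff $a\le_G b$ for some $a\in A$. A system of ideals for $G$ is a relation $\rhd$ between $\mathrm{P}_{\mathrm{fe}}^*(G)$ and $G$ with $a\rhd a$; $A\rhd b\Rightarrow A\cup A'\rhd b$; ($A\rhd c$ and $A\cup\{c\}\rhd b$) $\Rightarrow A\rhd b$; $a\le_G b\Rightarrow a\rhd b$; $A\rhd b\Rightarrow x+A\rhd x+b$. For $y_1,\dots,y_n\in G$, $\rhd_{y_1,\dots,y_n}$ denotes the finest system of ideals containing $\rhd$ with $0\rhd_{y_1,\dots,y_n}y_i$ for all $i$. The regularisation of $\rhd$: $A\vdash_\rhd B$ iff there exist $x_1,\dots,x_m\in G$ such that $A-B\rhd_{\pm x_1,\dots,\pm x_m}0$ for every choice of signs. -}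

module Defs where

open import Data.Bool using (Bool; true; false)
open import Data.Nat using (ℕ; zero; suc)
open import Data.Product using (Σ; ∃; _×_; _,_; proj₁; proj₂)
open import Data.List using (List; []; _∷_)
import Data.List as L
open import Data.List.NonEmpty using (List⁺; _∷_; toList; concatMap; _⁺++⁺_; [_])
import Data.List.NonEmpty as L⁺
open import Data.List.Membership.Propositional using (_∈_)
open import Data.Vec using (Vec)
import Data.Vec as V
open import Relation.Binary.PropositionalEquality using (_≡_)
open import Relation.Binary.Structures using (IsPartialOrder)
open import Algebra.Structures using (IsAbelianGroup)

record OrderedGroup : Set₁ where
  infixl 6 _+_
  infix 4 _≤_
  field
    Carrier        : Set
    _+_            : Carrier → Carrier → Carrier
    0#             : Carrier
    -_             : Carrier → Carrier
    isAbelianGroup : IsAbelianGroup _≡_ _+_ 0# -_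
    _≤_            : Carrier → Carrier → Set
    isPartialOrder : IsPartialOrder _≡_ _≤_
    +-mono-≤       : ∀ {x y} z → x ≤ y → z + x ≤ z + y

module _ (G : OrderedGroup) where
  open OrderedGroup G

  -- nonempty finite subsets of G, represented by nonempty lists
  -- (a list denotes the set of its members)
  Pfe : Set
  Pfe = List⁺ Carrier

  _∈ₛ_ : Carrier → Pfe → Set
  a ∈ₛ A = a ∈ toList A

  _⊆ₛ_ : Pfe → Pfe → Set
  A ⊆ₛ B = ∀ {a} → a ∈ₛ A → a ∈ₛ B

  _⊕_ : Pfe → Pfe → Pfe
  A ⊕ B = concatMap (λ a → L⁺.map (λ b → a + b) B) A

  _⊖_ : Pfe → Pfe → Pfe
  A ⊖ B = concatMap (λ a → L⁺.map (λ b → a + (- b)) B) A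

  -- A^(n) = A + ... + A (n times); A^(0) = {0} (only used with n ≥ 1)
  _^⁽_⁾ : Pfe → ℕ → Pfe
  A ^⁽ zero ⁾  = [ 0# ]
  A ^⁽ suc n ⁾ = (A ^⁽ n ⁾) ⊕ A

  _▷ₛ_ : Pfe → Carrier → Set
  A ▷ₛ b = Σ Carrier λ a → a ∈ₛ A × a ≤ b

  _+ₗ_ : Carrier → Pfe → Pfe
  x +ₗ A = L⁺.map (λ a → x + a) A

  -- ▷_{y₁,…,yₙ}: the finest system of ideals containing ▷ with 0 ▷ yᵢ,
  -- defined as the least relation closed under the axioms of a system of ideals.
  data Closure (R : Pfe → Carrier → Set) (ys : List Carrier) : Pfe → Carrier → Set where
    base    : ∀ {A b} → R A b → Closure R ys A b
    gen     : ∀ {y} → y ∈ ys → Closure R ys [ 0# ] y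
    reflex  : ∀ {a} → Closure R ys [ a ] a
    -- A ▷ b ⇒ A ∪ A' ▷ b (stated for lists as: every superset)
    weaken  : ∀ {A A' b} → A ⊆ₛ A' → Closure R ys A b → Closure R ys A' b
    cut     : ∀ {A b c} → Closure R ys A c → Closure R ys (c ∷ toList A) b → Closure R ys A b
    order   : ∀ {a b} → a ≤ b → Closure R ys [ a ] b
    shift   : ∀ {A b} x → Closure R ys A b → Closure R ys (x +ₗ A) (x + b)

  applySign : Bool → Carrier → Carrier
  applySign true  x = x
  applySign false x = - x

  -- regularisation of ▷: A ⊢ B iff there are x₁…xₘ with
  -- A - B ▷_{±x₁,…,±xₘ} 0 for every choice of signs
  Reg : (Pfe → Carrier → Set) → Pfe → Pfe → Set
  Reg R A B = Σ ℕ λ m → Σ (Vec Carrier m) λ xs →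
    (s : Vec Bool m) → Closure R (V.toList (V.zipWith applySign s xs)) (A ⊖ B) 0#

  _•_ : ℕ → Carrier → Carrier
  zero  • x = 0#
  suc n • x = x + (n • x)

  ΣL : List (ℕ × Carrier) → Carrier
  ΣL []             = 0#
  ΣL ((n , a) ∷ ps) = (n • a) + ΣL ps

-- In the closure of ▷ₛ with generators y₁ … yₘ, B ▷ b holds exactly when a + v ≤ b for
-- some a ∈ B and some finite sum v of the yᵢ (the relation _▷⟨_⟩_ below). So A ⊢ 0 says:
-- there are x₁ … xₘ such that for every choice of signs, a + v ≤ 0 for some a ∈ A and
-- some sum v of the ±xᵢ.
-- (1) ⇒ (2): eliminate the xᵢ one at a time, Fourier–Motzkin style. From c + k x + v ≤ 0
-- and c′ − k′ x + v′ ≤ 0 with k, k′ > 0, adding k′ times the first to k times the second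
-- cancels x (if k or k′ is 0 there is nothing to cancel), and c stays a nonempty sum of
-- elements of A.
-- (2) ⇒ (1): if a₁ + … + aₙ ≤ 0, take xᵢ = a₁ + … + aᵢ for i < n. For a choice of signs,
-- the first i with sign − gives aᵢ + xᵢ₋₁ − xᵢ = 0, and if every sign is + then
-- aₙ + xₙ₋₁ ≤ 0.
-- Condition (3) is (2) with repeated summands collected.
module Submission where

open import Defs
open import Level using (0ℓ)
open import Algebra.Bundles using (AbelianGroup)
open import Algebra.Structures using (IsAbelianGroup)
open import Data.Bool using (Bool; true; false)
open import Data.Nat using (ℕ; zero; suc; NonZero; ≢-nonZero⁻¹) renaming (_*_ to _*ℕ_)
open import Data.Nat.Properties using (*-comm)
open import Data.Product using (Σ; _×_; _,_; proj₁; proj₂; uncurry)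
open import Data.List
  using (List; []; _∷_; _++_; length; foldr; map; replicate; concatMap; cartesianProductWith)
open import Data.List.NonEmpty using (List⁺; _∷_; toList; [_]; _⁺++⁺_)
open import Data.List.NonEmpty.Properties using (toList->>=)
open import Data.List.Membership.Propositional using (_∈_)
open import Data.List.Membership.Propositional.Properties
  using (∈-map⁺; ∈-cartesianProductWith⁺; ∈-cartesianProductWith⁻)
open import Data.List.Relation.Binary.Subset.Propositional using (_⊆_)
open import Data.List.Relation.Binary.Subset.Propositional.Properties using (∈-∷⁺ʳ; ∷⁺ʳ)
open import Data.List.Relation.Unary.All using (All; []; _∷_)
import Data.List.Relation.Unary.All.Properties as All
open import Data.List.Relation.Unary.Any using (Any; here; there)
open import Data.Vec using (Vec; []; _∷_)
import Data.Vec as V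
open import Relation.Binary.PropositionalEquality
  using (_≡_; _≢_; refl; sym; trans; cong; cong₂; subst; subst₂; module ≡-Reasoning)
open import Relation.Binary.Structures using (IsPartialOrder)
open import Relation.Nullary using (contradiction)
open import Function.Base using (_∘_; id)
open import Function.Bundles using (_⇔_; mk⇔)
import Function.Properties.Equivalence as ⇔

module _ (G : OrderedGroup) where
  open OrderedGroup G
  open IsAbelianGroup isAbelianGroup using (assoc; comm; identityˡ; identityʳ; inverseʳ)
  open IsPartialOrder isPartialOrder using (reflexive) renaming (trans to ≤-trans)

  abelianGroup : AbelianGroup 0ℓ 0ℓ
  abelianGroup = record { isAbelianGroup = isAbelianGroup }

  open AbelianGroup abelianGroup using (commutativeMonoid; commutativeSemigroup)
  open import Algebra.Properties.AbelianGroup abelianGroup using (ε⁻¹≈ε)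
  open import Algebra.Properties.CommutativeSemigroup commutativeSemigroup
    using (interchange; x∙yz≈y∙xz)
  open import Algebra.Properties.CommutativeMonoid.Mult commutativeMonoid
    using (×-assocˡ; ×-distrib-+) renaming (_×_ to _·_)

  +-monoˡ-≤ : ∀ {x y} z → x ≤ y → x + z ≤ y + z
  +-monoˡ-≤ {x} {y} z x≤y = subst₂ _≤_ (comm z x) (comm z y) (+-mono-≤ z x≤y)

  +-nonpos : ∀ {x y} → x ≤ 0# → y ≤ 0# → x + y ≤ 0#
  +-nonpos {x} x≤0 y≤0 = ≤-trans (+-mono-≤ x y≤0) (subst (_≤ 0#) (sym (identityʳ x)) x≤0)

  ·-zeroʳ : ∀ n → n · 0# ≡ 0#
  ·-zeroʳ zero    = refl
  ·-zeroʳ (suc n) = trans (cong (0# +_) (·-zeroʳ n)) (identityˡ 0#)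

  ·-inverseʳ : ∀ n x → n · x + n · (- x) ≡ 0#
  ·-inverseʳ n x = begin
    n · x + n · (- x)  ≡⟨ sym (×-distrib-+ x (- x) n) ⟩
    n · (x + - x)      ≡⟨ cong (n ·_) (inverseʳ x) ⟩
    n · 0#             ≡⟨ ·-zeroʳ n ⟩
    0#                 ∎
    where open ≡-Reasoning

  ·-nonpos : ∀ n {x} → x ≤ 0# → n · x ≤ 0#
  ·-nonpos zero    x≤0 = reflexive refl
  ·-nonpos (suc n) x≤0 = +-nonpos x≤0 (·-nonpos n x≤0)

  ·-cancel : ∀ m n c d x u w →
             n · (c + (m · x + u)) + m · (d + (n · (- x) + w)) ≡ (n · c + m · d) + (n · u + m · w)
  ·-cancel m n c d x u w = begin
    n · (c + (m · x + u)) + m · (d + (n · (- x) + w))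
      ≡⟨ cong₂ _+_ (distrib₂ n c (m · x) u) (distrib₂ m d (n · (- x)) w) ⟩
    (n · c + (n · (m · x) + n · u)) + (m · d + (m · (n · (- x)) + m · w))
      ≡⟨ cong₂ (λ p q → (n · c + (p + n · u)) + (m · d + (q + m · w)))
               (×-assocˡ x n m) mn·-x≡nm·-x ⟩
    (n · c + (N · x + n · u)) + (m · d + (N · (- x) + m · w))
      ≡⟨ cong₂ _+_ (x∙yz≈y∙xz (n · c) (N · x) (n · u))
                   (x∙yz≈y∙xz (m · d) (N · (- x)) (m · w)) ⟩
    (N · x + (n · c + n · u)) + (N · (- x) + (m · d + m · w))
      ≡⟨ interchange (N · x) _ (N · (- x)) _ ⟩
    (N · x + N · (- x)) + S
      ≡⟨ trans (cong (_+ S) (·-inverseʳ N x)) (identityˡ S) ⟩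
    (n · c + n · u) + (m · d + m · w)
      ≡⟨ interchange (n · c) (n · u) (m · d) (m · w) ⟩
    (n · c + m · d) + (n · u + m · w) ∎
    where
      open ≡-Reasoning
      N : ℕ
      N = n *ℕ m
      S : Carrier
      S = (n · c + n · u) + (m · d + m · w)
      distrib₂ : ∀ k a b e → k · (a + (b + e)) ≡ k · a + (k · b + k · e)
      distrib₂ k a b e = trans (×-distrib-+ a (b + e) k) (cong (k · a +_) (×-distrib-+ b e k))
      mn·-x≡nm·-x : m · (n · (- x)) ≡ N · (- x)
      mn·-x≡nm·-x = trans (×-assocˡ (- x) m n) (cong (_· - x) (*-comm m n))

  data Cone (ys : List Carrier) : Carrier → Set where
    []  : Cone ys 0#
    _∷_ : ∀ {y v} → y ∈ ys → Cone ys v → Cone ys (y + v)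

  cone-gen : ∀ {ys y} → y ∈ ys → Cone ys y
  cone-gen {y = y} y∈ = subst (Cone _) (identityʳ y) (y∈ ∷ [])

  cone-+ : ∀ {ys u v} → Cone ys u → Cone ys v → Cone ys (u + v)
  cone-+ {v = v} []                q = subst (Cone _) (sym (identityˡ v)) q
  cone-+ {v = v} (_∷_ {y} {u} y∈ p) q = subst (Cone _) (sym (assoc y u v)) (y∈ ∷ cone-+ p q)

  cone-· : ∀ {ys} n {v} → Cone ys v → Cone ys (n · v)
  cone-· zero    p = []
  cone-· (suc n) p = cone-+ p (cone-· n p)

  cone-[] : ∀ {v} → Cone [] v → v ≡ 0#
  cone-[] [] = refl

  cone-split : ∀ {x ys v} → Cone (x ∷ ys) v →
               Σ ℕ λ k → Σ Carrier λ u → Cone ys u × v ≡ k · x + u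
  cone-split [] = 0 , 0# , [] , sym (identityˡ 0#)
  cone-split (here refl ∷ p) with cone-split p
  ... | k , u , u∈ , refl = suc k , u , u∈ , sym (assoc _ _ _)
  cone-split (_∷_ {y} (there y∈) p) with cone-split p
  ... | k , u , u∈ , refl = k , y + u , y∈ ∷ u∈ , x∙yz≈y∙xz y _ u

  infix 4 _▷⟨_⟩_
  _▷⟨_⟩_ : (Carrier → Set) → List Carrier → Carrier → Set
  P ▷⟨ ys ⟩ b = Σ Carrier λ a → P a × Σ Carrier λ v → Cone ys v × a + v ≤ b

  ▷⟨⟩-map : ∀ {P Q : Carrier → Set} {ys b} →
            (∀ {a} → P a → Q a) → P ▷⟨ ys ⟩ b → Q ▷⟨ ys ⟩ b
  ▷⟨⟩-map P⇒Q (a , Pa , v , v∈ , le) = a , P⇒Q Pa , v , v∈ , le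

  ▷⟨⟩-≤ : ∀ {P : Carrier → Set} {ys a b} → P a → a ≤ b → P ▷⟨ ys ⟩ b
  ▷⟨⟩-≤ {a = a} Pa a≤b = a , Pa , 0# , [] , subst (_≤ _) (sym (identityʳ a)) a≤b

  ▷⟨[]⟩ : ∀ {P : Carrier → Set} {b} → P ▷⟨ [] ⟩ b → Σ Carrier λ a → P a × a ≤ b
  ▷⟨[]⟩ (a , Pa , v , v∈ , le) =
    a , Pa , subst (_≤ _) (identityʳ a) (subst (λ w → a + w ≤ _) (cone-[] v∈) le)

  ▷⟨⟩-cut : ∀ {B : List Carrier} {ys b c} →
            (_∈ B) ▷⟨ ys ⟩ c → (_∈ c ∷ B) ▷⟨ ys ⟩ b → (_∈ B) ▷⟨ ys ⟩ b
  ▷⟨⟩-cut (a , a∈ , v , v∈ , a+v≤c) (_ , here refl , w , w∈ , c+w≤b) =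
    a , a∈ , v + w , cone-+ v∈ w∈ ,
    ≤-trans (reflexive (sym (assoc a v w))) (≤-trans (+-monoˡ-≤ w a+v≤c) c+w≤b)
  ▷⟨⟩-cut _ (a , there a∈ , w , w∈ , le) = a , a∈ , w , w∈ , le

  ▷⟨⟩-shift : ∀ {B : List⁺ Carrier} {ys b} x →
              (_∈ toList B) ▷⟨ ys ⟩ b → (_∈ toList (_+ₗ_ G x B)) ▷⟨ ys ⟩ (x + b)
  ▷⟨⟩-shift x (a , a∈ , v , v∈ , a+v≤b) =
    x + a , ∈-map⁺ (x +_) a∈ , v , v∈ , ≤-trans (reflexive (assoc x a v)) (+-mono-≤ x a+v≤b)

  closure⇒▷⟨⟩ : ∀ {ys B b} → Closure G (_▷ₛ_ G) ys B b → (_∈ toList B) ▷⟨ ys ⟩ b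
  closure⇒▷⟨⟩ (base (a , a∈ , a≤b)) = ▷⟨⟩-≤ a∈ a≤b
  closure⇒▷⟨⟩ (gen y∈)               = 0# , here refl , _ , cone-gen y∈ , reflexive (identityˡ _)
  closure⇒▷⟨⟩ reflex                 = ▷⟨⟩-≤ (here refl) (reflexive refl)
  closure⇒▷⟨⟩ (weaken B⊆B′ p)        = ▷⟨⟩-map B⊆B′ (closure⇒▷⟨⟩ p)
  closure⇒▷⟨⟩ (cut p q)              = ▷⟨⟩-cut (closure⇒▷⟨⟩ p) (closure⇒▷⟨⟩ q)
  closure⇒▷⟨⟩ (order a≤b)            = ▷⟨⟩-≤ (here refl) a≤b
  closure⇒▷⟨⟩ (shift x p)            = ▷⟨⟩-shift x (closure⇒▷⟨⟩ p)

  cone⇒closure : ∀ {ys a v} → Cone ys v → Closure G (_▷ₛ_ G) ys [ a ] (a + v)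
  cone⇒closure {a = a} [] = order (reflexive (sym (identityʳ a)))
  cone⇒closure {ys} {a} (_∷_ {y} {v} y∈ p) =
    cut (cone⇒closure p) (weaken (∷⁺ʳ (a + v) λ ()) translate-gen)
    where
      translate-gen : Closure G (_▷ₛ_ G) ys [ a + v ] (a + (y + v))
      translate-gen = subst₂ (Closure G (_▷ₛ_ G) ys) (cong [_] (identityʳ (a + v)))
        (trans (assoc a v y) (cong (a +_) (comm v y))) (shift (a + v) (gen y∈))

  ▷⟨⟩⇒closure : ∀ {ys B b} → (_∈ toList B) ▷⟨ ys ⟩ b → Closure G (_▷ₛ_ G) ys B b
  ▷⟨⟩⇒closure (a , a∈ , v , v∈ , a+v≤b) =
    weaken (∈-∷⁺ʳ a∈ λ ())
      (cut (cone⇒closure v∈) (weaken (∷⁺ʳ (a + v) λ ()) (order a+v≤b)))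

  toList-⊕ : ∀ B C → toList (_⊕_ G B C) ≡ cartesianProductWith _+_ (toList B) (toList C)
  toList-⊕ B C = trans (sym (toList->>= _ B)) (concatMap-translates (toList B))
    where
      concatMap-translates : ∀ l →
        concatMap (λ a → map (a +_) (toList C)) l ≡ cartesianProductWith _+_ l (toList C)
      concatMap-translates []      = refl
      concatMap-translates (a ∷ l) = cong (map (a +_) (toList C) ++_) (concatMap-translates l)

  ∈-⊕⁺ : ∀ {B C x y} → x ∈ toList B → y ∈ toList C → x + y ∈ toList (_⊕_ G B C)
  ∈-⊕⁺ {B} {C} {x} {y} x∈ y∈ =
    subst (x + y ∈_) (sym (toList-⊕ B C)) (∈-cartesianProductWith⁺ _+_ x∈ y∈)

  ∈-⊕⁻ : ∀ B C {z} → z ∈ toList (_⊕_ G B C) →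
         Σ Carrier λ x → Σ Carrier λ y → x ∈ toList B × y ∈ toList C × z ≡ x + y
  ∈-⊕⁻ B C {z} z∈ =
    ∈-cartesianProductWith⁻ _+_ (toList B) (toList C) (subst (z ∈_) (toList-⊕ B C) z∈)

  x-0≡x : ∀ x → x + - 0# ≡ x
  x-0≡x x = trans (cong (x +_) ε⁻¹≈ε) (identityʳ x)

  ∈-⊖[0]⁺ : ∀ {B a} → a ∈ toList B → a ∈ toList (_⊖_ G B [ 0# ])
  ∈-⊖[0]⁺ {B} {a} a∈ =
    subst (_∈ toList (_⊖_ G B [ 0# ])) (x-0≡x a) (∈-⊕⁺ {B} {[ - 0# ]} a∈ (here refl))

  ∈-⊖[0]⁻ : ∀ {B a} → a ∈ toList (_⊖_ G B [ 0# ]) → a ∈ toList B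
  ∈-⊖[0]⁻ {B} a∈ with ∈-⊕⁻ B [ - 0# ] a∈
  ... | x , _ , x∈ , here refl , refl = subst (_∈ toList B) (sym (x-0≡x x)) x∈

  sum : List Carrier → Carrier
  sum = foldr _+_ 0#

  sum-++ : ∀ l l′ → sum (l ++ l′) ≡ sum l + sum l′
  sum-++ []      l′ = sym (identityˡ (sum l′))
  sum-++ (a ∷ l) l′ = trans (cong (a +_) (sum-++ l l′)) (sym (assoc a (sum l) (sum l′)))

  ∈-^⁺ : ∀ {A l} → All (_∈ toList A) l → sum l ∈ toList (_^⁽_⁾ G A (length l))
  ∈-^⁺ []                   = here refl
  ∈-^⁺ {A} {a ∷ l} (a∈ ∷ l∈) =
    subst (_∈ toList (_^⁽_⁾ G A (suc (length l)))) (comm (sum l) a) (∈-⊕⁺ (∈-^⁺ l∈) a∈)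

  ∈-^⁻ : ∀ A n {z} → z ∈ toList (_^⁽_⁾ G A n) →
         Σ (List Carrier) λ l → length l ≡ n × All (_∈ toList A) l × sum l ≡ z
  ∈-^⁻ A zero    (here refl) = [] , refl , [] , refl
  ∈-^⁻ A (suc n) z∈ with ∈-⊕⁻ (_^⁽_⁾ G A n) A z∈
  ... | x , a , x∈ , a∈ , refl with ∈-^⁻ A n x∈
  ... | l , refl , l∈ , refl = a ∷ l , refl , a∈ ∷ l∈ , comm a (sum l)

  NonemptySum : List⁺ Carrier → Carrier → Set
  NonemptySum A c = Σ (List⁺ Carrier) λ l → All (_∈ toList A) (toList l) × sum (toList l) ≡ c

  nonemptySum-∈ : ∀ {A a} → a ∈ toList A → NonemptySum A a
  nonemptySum-∈ {a = a} a∈ = [ a ] , a∈ ∷ [] , identityʳ a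

  nonemptySum-+ : ∀ {A c d} → NonemptySum A c → NonemptySum A d → NonemptySum A (c + d)
  nonemptySum-+ (l , l∈ , refl) (l′ , l′∈ , refl) =
    l ⁺++⁺ l′ , All.++⁺ l∈ l′∈ , sum-++ (toList l) (toList l′)

  NonpositiveSum : List⁺ Carrier → Set
  NonpositiveSum A = Σ Carrier λ c → NonemptySum A c × c ≤ 0#

  ^⇒nonemptySum : ∀ {A} n {z} → .{{NonZero n}} → z ∈ toList (_^⁽_⁾ G A n) → NonemptySum A z
  ^⇒nonemptySum {A} n z∈ with ∈-^⁻ A n z∈
  ... | []    , refl , _  , _  = contradiction refl (≢-nonZero⁻¹ 0)
  ... | a ∷ l , _    , l∈ , eq = a ∷ l , l∈ , eq

  nonemptySum⇒^ : ∀ {A z} → NonemptySum A z →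
                  Σ ℕ λ n → NonZero n × z ∈ toList (_^⁽_⁾ G A n)
  nonemptySum⇒^ (l , l∈ , refl) = length (toList l) , _ , ∈-^⁺ l∈

  signed : ∀ {m} → Vec Bool m → Vec Carrier m → List Carrier
  signed s xs = V.toList (V.zipWith (applySign G) s xs)

  module _ {P : Carrier → Set} (P-+ : ∀ {c d} → P c → P d → P (c + d)) where

    P-· : ∀ n {c} → P c → P (suc n · c)
    P-· zero    {c} Pc = subst P (sym (identityʳ c)) Pc
    P-· (suc n)     Pc = P-+ Pc (P-· n Pc)

    eliminate-± : ∀ {x ys} →
                  P ▷⟨ x ∷ ys ⟩ 0# → P ▷⟨ - x ∷ ys ⟩ 0# → P ▷⟨ ys ⟩ 0#
    eliminate-± (c₁ , Pc₁ , _ , v₁∈ , le₁) (c₂ , Pc₂ , _ , v₂∈ , le₂)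
      with cone-split v₁∈ | cone-split v₂∈
    ... | zero , u₁ , u₁∈ , refl | _ =
      c₁ , Pc₁ , u₁ , u₁∈ , subst (λ v → c₁ + v ≤ 0#) (identityˡ u₁) le₁
    ... | suc _ , _ , _ , _ | zero , u₂ , u₂∈ , refl =
      c₂ , Pc₂ , u₂ , u₂∈ , subst (λ v → c₂ + v ≤ 0#) (identityˡ u₂) le₂
    ... | suc j₁ , u₁ , u₁∈ , refl | suc j₂ , u₂ , u₂∈ , refl =
      k₂ · c₁ + k₁ · c₂ , P-+ (P-· j₂ Pc₁) (P-· j₁ Pc₂) ,
      k₂ · u₁ + k₁ · u₂ , cone-+ (cone-· k₂ u₁∈) (cone-· k₁ u₂∈) ,
      subst (_≤ 0#) (·-cancel k₁ k₂ c₁ c₂ _ u₁ u₂)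
        (+-nonpos (·-nonpos k₂ le₁) (·-nonpos k₁ le₂))
      where
        k₁ k₂ : ℕ
        k₁ = suc j₁
        k₂ = suc j₂

    eliminate : ∀ {m} (xs : Vec Carrier m) →
                (∀ s → P ▷⟨ signed s xs ⟩ 0#) → Σ Carrier λ c → P c × c ≤ 0#
    eliminate []       H = ▷⟨[]⟩ (H [])
    eliminate (x ∷ xs) H = eliminate xs λ s → eliminate-± (H (true ∷ s)) (H (false ∷ s))

  partialSums : Carrier → (l : List Carrier) → Vec Carrier (length l)
  partialSums q []      = []
  partialSums q (b ∷ l) = q ∷ partialSums (q + b) l

  telescope : ∀ {A zs p a} rest →
              All (_∈ toList A) (a ∷ rest) → p + sum (a ∷ rest) ≤ 0# → Cone zs p →
              (s : Vec Bool (length rest)) → signed s (partialSums (p + a) rest) ⊆ zs →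
              (_∈ toList A) ▷⟨ zs ⟩ 0#
  telescope {p = p} {a} [] (a∈ ∷ []) le p∈ [] _ =
    a , a∈ , p , p∈ , subst (_≤ 0#) (trans (cong (p +_) (identityʳ a)) (comm p a)) le
  telescope {p = p} {a} (_ ∷ _) (a∈ ∷ _) _ p∈ (false ∷ _) sub =
    a , a∈ , p + - (p + a) , cone-+ p∈ (cone-gen (sub (here refl))) , reflexive a+[p-[p+a]]≡0
    where
      a+[p-[p+a]]≡0 : a + (p + - (p + a)) ≡ 0#
      a+[p-[p+a]]≡0 =
        trans (sym (assoc a p _)) (trans (cong (_+ - (p + a)) (comm a p)) (inverseʳ (p + a)))
  telescope {p = p} {a} (_ ∷ rest) (_ ∷ rest∈) le _ (true ∷ s) sub =
    telescope rest rest∈ (subst (_≤ 0#) (sym (assoc p a _)) le)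
              (cone-gen (sub (here refl))) s (sub ∘ there)

  reg⇒nonpositiveSum : ∀ {A} → Reg G (_▷ₛ_ G) A [ 0# ] → NonpositiveSum A
  reg⇒nonpositiveSum (_ , xs , H) =
    eliminate nonemptySum-+ xs λ s →
      ▷⟨⟩-map (nonemptySum-∈ ∘ ∈-⊖[0]⁻) (closure⇒▷⟨⟩ (H s))

  nonpositiveSum⇒reg : ∀ {A} → NonpositiveSum A → Reg G (_▷ₛ_ G) A [ 0# ]
  nonpositiveSum⇒reg (_ , (a ∷ rest , l∈ , refl) , le) =
    length rest , partialSums (0# + a) rest , λ s →
      ▷⟨⟩⇒closure (▷⟨⟩-map ∈-⊖[0]⁺ (telescope rest l∈ 0+Σ≤0 [] s id))
    where
      0+Σ≤0 : 0# + sum (a ∷ rest) ≤ 0#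
      0+Σ≤0 = subst (_≤ 0#) (sym (identityˡ _)) le

  ^▷ₛ0⇔nonpositiveSum : ∀ {A} →
    Σ ℕ (λ n → NonZero n × _▷ₛ_ G (_^⁽_⁾ G A n) 0#) ⇔ NonpositiveSum A
  ^▷ₛ0⇔nonpositiveSum = mk⇔
    (λ (n , n≢0 , c , c∈ , c≤0) → c , ^⇒nonemptySum n {{n≢0}} c∈ , c≤0)
    (λ (c , c∈⁺ , c≤0) →
       let n , n≢0 , c∈ = nonemptySum⇒^ c∈⁺ in n , n≢0 , c , c∈ , c≤0)

  expand : List (ℕ × Carrier) → List Carrier
  expand = concatMap (uncurry replicate)

  sum-expand : ∀ ps → sum (expand ps) ≡ ΣL G ps
  sum-expand []             = refl
  sum-expand ((k , a) ∷ ps) =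
    trans (sum-++ (replicate k a) (expand ps)) (cong₂ _+_ (sum-replicate k) (sum-expand ps))
    where
      sum-replicate : ∀ k → sum (replicate k a) ≡ _•_ G k a
      sum-replicate zero    = refl
      sum-replicate (suc k) = cong (a +_) (sum-replicate k)

  All-expand : ∀ {A ps} → All (λ p → proj₂ p ∈ toList A) ps → All (_∈ toList A) (expand ps)
  All-expand                      []          = []
  All-expand {ps = (k , _) ∷ _} (a∈ ∷ ps∈) = All.++⁺ (All.replicate⁺ k a∈) (All-expand ps∈)

  expand-nonZero : ∀ {ps} → Any (λ p → proj₁ p ≢ 0) ps → NonZero (length (expand ps))
  expand-nonZero {(zero  , _) ∷ _} (here 0≢0) = contradiction refl 0≢0
  expand-nonZero {(zero  , _) ∷ _} (there ps) = expand-nonZero ps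
  expand-nonZero {(suc _ , _) ∷ _} _          = _

  ΣL-ones : ∀ l → ΣL G (map (1 ,_) l) ≡ sum l
  ΣL-ones []      = refl
  ΣL-ones (a ∷ l) = cong₂ _+_ (identityʳ a) (ΣL-ones l)

  combination≤0⇔nonpositiveSum : ∀ {A} →
    Σ (List (ℕ × Carrier)) (λ ps → All (λ p → proj₂ p ∈ toList A) ps
                                 × Any (λ p → proj₁ p ≢ 0) ps × ΣL G ps ≤ 0#)
      ⇔ NonpositiveSum A
  combination≤0⇔nonpositiveSum = mk⇔
    (λ (ps , ps∈ , ps≢0 , ps≤0) → sum (expand ps) ,
       ^⇒nonemptySum (length (expand ps)) {{expand-nonZero ps≢0}} (∈-^⁺ (All-expand ps∈)) ,
       subst (_≤ 0#) (sym (sum-expand ps)) ps≤0)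
    λ { (_ , (l , l∈ , refl) , c≤0) → map (1 ,_) (toList l) , All.map⁺ l∈ , here (λ ()) ,
          subst (_≤ 0#) (sym (ΣL-ones (toList l))) c≤0 }

proposition4p11 : (G : OrderedGroup) → let open OrderedGroup G in (A : Pfe G) →
    (Reg G (_▷ₛ_ G) A [ 0# ] ⇔ Σ ℕ (λ n → NonZero n × _▷ₛ_ G (_^⁽_⁾ G A n) 0#))
    × (Σ ℕ (λ n → NonZero n × _▷ₛ_ G (_^⁽_⁾ G A n) 0#)
    ⇔ Σ (List (ℕ × Carrier)) (λ ps → All (λ p → _∈ₛ_ G (proj₂ p) A) ps
    × Any (λ p → proj₁ p ≢ 0) ps × ΣL G ps ≤ 0#))
proposition4p11 G A =
  ⇔.trans (mk⇔ (reg⇒nonpositiveSum G) (nonpositiveSum⇒reg G))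
          (⇔.sym (^▷ₛ0⇔nonpositiveSum G)) ,
  ⇔.trans (^▷ₛ0⇔nonpositiveSum G) (⇔.sym (combination≤0⇔nonpositiveSum G))
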